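{- Let $n>1$ be an integer and let $a,b\in\mathbb Z_n$ be incomparable with respect to $\leq$. Let $d=\gcd(\gcd(a-1,b-1),n)$. Then the meet $a\wedge b$ (greatest lower bound of $\{a,b\}$) exists in $(\mathbb Z_n,\leq)$ if and only if the ideal $(n/d)$ of $\mathbb Z_n$ has a largest element with respect to $\leq$.
   Context: On $\mathbb Z_n$ define the partial order $\leq$ by: $a\leq b$ iff $a=b$ or $a\equiv ab\pmod n$. For $x\in\mathbb Z_n$, $(x)$ denotes the ideal of $\mathbb Z_n$ generated by $x$. Gcds are taken of integer representatives. -}

module Defs where

open import Data.Nat using (ℕ; _*_; NonZero)
open import Data.Nat.DivMod using (_%_)
open import Data.Nat.GCD using (gcd; gcd[m,n]∣n)
open import Data.Nat.Divisibility using (quotient)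
open import Data.Fin using (Fin; toℕ)
open import Data.Integer using (ℤ; +_; _-_; ∣_∣)
open import Data.Product using (Σ; ∃; _×_)
open import Data.Sum using (_⊎_)
open import Relation.Binary.PropositionalEquality using (_≡_)
open import Relation.Nullary using (¬_)

module Zn (n : ℕ) .{{_ : NonZero n}} where

  _·_ : Fin n → Fin n → ℕ
  a · b = (toℕ a * toℕ b) % n

  _≼_ : Fin n → Fin n → Set
  a ≼ b = a ≡ b ⊎ toℕ a ≡ a · b

  Incomparable : Fin n → Fin n → Set
  Incomparable a b = ¬ (a ≼ b) × ¬ (b ≼ a)

  IsMeet : Fin n → Fin n → Fin n → Set
  IsMeet a b m = (m ≼ a × m ≼ b) × (∀ c → c ≼ a → c ≼ b → c ≼ m)

  MeetExists : Fin n → Fin n → Set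
  MeetExists a b = ∃ λ m → IsMeet a b m

  InIdeal : ℕ → Fin n → Set
  InIdeal x y = ∃ λ (k : Fin n) → toℕ y ≡ (toℕ k * x) % n

  HasLargest : ℕ → Set
  HasLargest x = ∃ λ m → InIdeal x m × (∀ y → InIdeal x y → y ≼ m)

  d : Fin n → Fin n → ℕ
  d a b = gcd (gcd ∣ + toℕ a - + 1 ∣ ∣ + toℕ b - + 1 ∣) n

  n/d : Fin n → Fin n → ℕ
  n/d a b = quotient (gcd[m,n]∣n (gcd ∣ + toℕ a - + 1 ∣ ∣ + toℕ b - + 1 ∣) n)

-- A lower bound c of two incomparable elements a, b differs from both, so
-- c ≼ a and c ≼ b mean c ≡ ca ≡ cb, i.e. n ∣ c(a-1) and n ∣ c(b-1).  By
-- distributivity of multiplication over gcd this is n ∣ cd, i.e. (n/d) ∣ c.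
-- Hence the lower bounds of {a, b} form exactly the ideal (n/d), and a meet
-- is the same thing as a largest element of that ideal.
module Submission where

open import Defs
open import Data.Nat using (ℕ; _<_; NonZero)
open import Data.Fin using (Fin)
open import Function.Bundles using (_⇔_)

open import Data.Nat.Base using (zero; suc; _+_; _*_; _/_; _%_; ≢-nonZero⁻¹)
open import Data.Nat.Properties
open import Data.Nat.DivMod using (m≡m%n+[m/n]*n; m<n⇒m%n≡m; %-remove-+ʳ)
open import Data.Nat.GCD using (gcd; gcd-greatest; gcd[m,n]∣m; gcd[m,n]∣n; c*gcd[m,n]≡gcd[cm,cn])
open import Data.Nat.Divisibility
open import Data.Fin.Base using (toℕ; fromℕ<)
open import Data.Fin.Properties using (toℕ<n; toℕ-fromℕ<)
import Data.Integer.Base as ℤ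
open import Data.Product.Base using (∃; _×_; _,_; proj₁)
open import Data.Product.Function.NonDependent.Propositional using (_×-⇔_)
open import Data.Sum.Base using (inj₁; inj₂)
open import Data.Empty using (⊥-elim)
open import Function.Bundles using (mk⇔; Equivalence)
open import Function.Properties.Equivalence using () renaming (sym to ⇔-sym)
import Function.Related.Propositional as Related
open import Relation.Binary.PropositionalEquality
  using (_≡_; refl; sym; trans; cong; subst; module ≡-Reasoning)

private
  variable
    c m n : ℕ

∣-nonZero : .{{NonZero n}} → m ∣ n → NonZero m
∣-nonZero {n} {zero} 0∣n = ⊥-elim (≢-nonZero⁻¹ n (0∣⇒≡0 0∣n))
∣-nonZero {m = suc _} _ = _

m*0%n≡0 : ∀ m n .{{_ : NonZero n}} → (m * 0) % n ≡ 0
m*0%n≡0 m n = n∣m⇒m%n≡0 (m * 0) n (subst (n ∣_) (sym (*-zeroʳ m)) (n ∣0))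

-- a - 1 is taken as the integer distance |a - 1|, as in the definition of d.
fixed⇔∣*[a-1] : .{{_ : NonZero n}} → c < n → ∀ a →
                c ≡ (c * a) % n ⇔ n ∣ c * ℤ.∣ ℤ.+ a ℤ.- ℤ.+ 1 ∣
fixed⇔∣*[a-1] {n} {c} c<n zero = mk⇔ to from
  where
  to : c ≡ (c * 0) % n → n ∣ c * 1
  to c≡0 = subst (n ∣_) (sym (trans (*-identityʳ c) (trans c≡0 (m*0%n≡0 c n)))) (n ∣0)

  from : n ∣ c * 1 → c ≡ (c * 0) % n
  from n∣c = begin
    c             ≡⟨ m<n⇒m%n≡m c<n ⟨
    c % n         ≡⟨ n∣m⇒m%n≡0 c n (subst (n ∣_) (*-identityʳ c) n∣c) ⟩
    0             ≡⟨ m*0%n≡0 c n ⟨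
    (c * 0) % n   ∎
    where open ≡-Reasoning
fixed⇔∣*[a-1] {n} {c} c<n (suc k) = mk⇔ to from
  where
  open ≡-Reasoning

  to : c ≡ (c * suc k) % n → n ∣ c * k
  to c≡ = divides ((c * suc k) / n) (+-cancelˡ-≡ c (c * k) _ (begin
    c + c * k                                ≡⟨ *-suc c k ⟨
    c * suc k                                ≡⟨ m≡m%n+[m/n]*n (c * suc k) n ⟩
    (c * suc k) % n + (c * suc k) / n * n    ≡⟨ cong (_+ (c * suc k) / n * n) c≡ ⟨
    c + (c * suc k) / n * n                  ∎))

  from : n ∣ c * k → c ≡ (c * suc k) % n
  from n∣ck = sym (begin
    (c * suc k) % n    ≡⟨ cong (_% n) (*-suc c k) ⟩
    (c + c * k) % n    ≡⟨ %-remove-+ʳ c n∣ck ⟩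
    c % n              ≡⟨ m<n⇒m%n≡m c<n ⟩
    c                  ∎)

∣*×∣*⇔∣*gcd : ∀ c x y → (n ∣ c * x × n ∣ c * y) ⇔ n ∣ c * gcd x y
∣*×∣*⇔∣*gcd {n} c x y = mk⇔
  (λ (n∣cx , n∣cy) → subst (n ∣_) (sym (c*gcd[m,n]≡gcd[cm,cn] c x y)) (gcd-greatest n∣cx n∣cy))
  (λ n∣cg → ∣-trans n∣cg (*-monoʳ-∣ c (gcd[m,n]∣m x y)) , ∣-trans n∣cg (*-monoʳ-∣ c (gcd[m,n]∣n x y)))

∣*gcd⇔∣*gcd[gcd,n] : ∀ c x y → n ∣ c * gcd x y ⇔ n ∣ c * gcd (gcd x y) n
∣*gcd⇔∣*gcd[gcd,n] {n} c x y = mk⇔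
  (λ n∣cg → Equivalence.to (∣*×∣*⇔∣*gcd c (gcd x y) n) (n∣cg , n∣m*n c))
  (λ n∣cg' → proj₁ (Equivalence.from (∣*×∣*⇔∣*gcd c (gcd x y) n) n∣cg'))

∣*⇔quotient∣ : .{{_ : NonZero n}} → (m∣n : m ∣ n) → n ∣ c * m ⇔ quotient m∣n ∣ c
∣*⇔quotient∣ {n} {m} {c} m∣n = mk⇔
  (λ n∣cm → *-cancelʳ-∣ m {{∣-nonZero m∣n}} (subst (_∣ c * m) n≡qm n∣cm))
  (λ q∣c → subst (_∣ c * m) (sym n≡qm) (*-monoˡ-∣ m q∣c))
  where
  n≡qm : n ≡ quotient m∣n * m
  n≡qm = m∣n⇒n≡quotient*m m∣n

HasGreatestLowerBound⇔HasGreatest : ∀ {A : Set} (_≤_ : A → A → Set) (P : A → Set) {a b : A} →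
  (∀ c → (c ≤ a × c ≤ b) ⇔ P c) →
  (∃ λ m → (m ≤ a × m ≤ b) × (∀ c → c ≤ a → c ≤ b → c ≤ m)) ⇔
  (∃ λ m → P m × (∀ c → P c → c ≤ m))
HasGreatestLowerBound⇔HasGreatest _≤_ P {a} {b} lower⇔P = mk⇔
  (λ (m , m-lower , m-greatest) → m , to m m-lower ,
     λ c Pc → let (c≤a , c≤b) = from c Pc in m-greatest c c≤a c≤b)
  (λ (m , Pm , m-greatest) → m , from m Pm ,
     λ c c≤a c≤b → m-greatest c (to c (c≤a , c≤b)))
  where
  to : ∀ c → c ≤ a × c ≤ b → P c
  to c = Equivalence.to (lower⇔P c)

  from : ∀ c → P c → c ≤ a × c ≤ b
  from c = Equivalence.from (lower⇔P c)

module _ (n : ℕ) .{{_ : NonZero n}} where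
  open Zn n

  InIdeal⇔∣ : ∀ {q} → q ∣ n → ∀ c → InIdeal q c ⇔ q ∣ toℕ c
  InIdeal⇔∣ {q} q∣n c = mk⇔ to from
    where
    to : InIdeal q c → q ∣ toℕ c
    to (k , c≡kq%n) = subst (q ∣_) (sym c≡kq%n) (%-presˡ-∣ (n∣m*n (toℕ k)) q∣n)

    from : q ∣ toℕ c → InIdeal q c
    from (divides j c≡jq) = fromℕ< j<n , (begin
      toℕ c                        ≡⟨ c≡jq ⟩
      j * q                        ≡⟨ m<n⇒m%n≡m jq<n ⟨
      (j * q) % n                  ≡⟨ cong (λ i → (i * q) % n) (toℕ-fromℕ< j<n) ⟨
      (toℕ (fromℕ< j<n) * q) % n   ∎)
      where
      open ≡-Reasoning
      jq<n : j * q < n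
      jq<n = subst (_< n) c≡jq (toℕ<n c)
      j<n : j < n
      j<n = ≤-<-trans (m≤m*n j q {{∣-nonZero q∣n}}) jq<n

  lowerBound⇔fixed : ∀ {a b} → Incomparable a b → ∀ c →
                     (c ≼ a × c ≼ b) ⇔ (toℕ c ≡ c · a × toℕ c ≡ c · b)
  lowerBound⇔fixed {a} {b} (a⋠b , b⋠a) c = mk⇔ to (λ (c≡ca , c≡cb) → inj₂ c≡ca , inj₂ c≡cb)
    where
    to : c ≼ a × c ≼ b → toℕ c ≡ c · a × toℕ c ≡ c · b
    to (inj₁ refl , c≼b)   = ⊥-elim (a⋠b c≼b)
    to (c≼a , inj₁ refl)   = ⊥-elim (b⋠a c≼a)
    to (inj₂ c≡ca , inj₂ c≡cb) = c≡ca , c≡cb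

  lowerBound⇔InIdeal : ∀ {a b} → Incomparable a b → ∀ c →
                       (c ≼ a × c ≼ b) ⇔ InIdeal (n/d a b) c
  lowerBound⇔InIdeal {a} {b} inc c = begin
    (c ≼ a × c ≼ b)                          ∼⟨ lowerBound⇔fixed inc c ⟩
    (toℕ c ≡ c · a × toℕ c ≡ c · b)          ∼⟨ fixed⇔∣*[a-1] c<n (toℕ a) ×-⇔ fixed⇔∣*[a-1] c<n (toℕ b) ⟩
    (n ∣ toℕ c * a-1 × n ∣ toℕ c * b-1)      ∼⟨ ∣*×∣*⇔∣*gcd (toℕ c) a-1 b-1 ⟩
    n ∣ toℕ c * gcd a-1 b-1                  ∼⟨ ∣*gcd⇔∣*gcd[gcd,n] (toℕ c) a-1 b-1 ⟩
    n ∣ toℕ c * d a b                        ∼⟨ ∣*⇔quotient∣ (gcd[m,n]∣n (gcd a-1 b-1) n) ⟩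
    n/d a b ∣ toℕ c                          ∼⟨ ⇔-sym (InIdeal⇔∣ (quotient-∣ (gcd[m,n]∣n (gcd a-1 b-1) n)) c) ⟩
    InIdeal (n/d a b) c                      ∎
    where
    open Related.EquationalReasoning
    c<n : toℕ c < n
    c<n = toℕ<n c
    a-1 b-1 : ℕ
    a-1 = ℤ.∣ ℤ.+ toℕ a ℤ.- ℤ.+ 1 ∣
    b-1 = ℤ.∣ ℤ.+ toℕ b ℤ.- ℤ.+ 1 ∣

theorem3p3 : (n : ℕ) .{{_ : NonZero n}} → 1 < n → (a b : Fin n) →
    Zn.Incomparable n a b →
    Zn.MeetExists n a b ⇔ Zn.HasLargest n (Zn.n/d n a b)
theorem3p3 n _ a b inc =
  HasGreatestLowerBound⇔HasGreatest (Zn._≼_ n) (Zn.InIdeal n (Zn.n/d n a b))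
    (lowerBound⇔InIdeal n inc)
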